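{- Let $k\ge1$ be an integer and let $S=s_1,s_2,\dots$ be an infinite sequence. Then $S$ is $k$-special if and only if the edge-coloring of the infinite $k$-ary tree $T_k$ derived from $S$ is nonrepetitive.
   Context: $T_k$ is the infinite rooted tree in which every vertex has exactly $k$ children, the children of each vertex being ordered left to right. The edge-coloring derived from $S$ is defined as follows: the edges from the root to its children, from left to right, receive indices $1,2,\dots,k$; if $v$ is a non-root vertex and the edge from $v$ to its parent has index $i$, then the edges from $v$ to its children, from left to right, receive indices $i+1,\dots,i+k$; an edge with index $i$ receives color $s_i$. A repetition is a finite sequence $x_1,\dots,x_{2r}$ ($r\ge1$) with $x_j=x_{j+r}$ for $1\le j\le r$. An edge-coloring is nonrepetitive if the sequence of colors along no path with at least one edge is a repetition. A sequence of indices $i_1,\dots,i_{2r}$ ($r\ge 1$) is $k$-bad for $S$ if there is $m$ with $1<m\le 2r$ such that: (a) $s_{i_j}=s_{i_{j+r}}$ for $1\le j\le r$; (b) $i_1>i_2>\dots>i_m<i_{m+1}<\dots<i_{2r}$; (c) $|i_j-i_{j+1}|\le k$ for $1\le j<2r$; (d) $i_{m+1}<i_m+k$ if $m<2r$. $S$ is $k$-special if it has no $k$-bad sequence of indices. -}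

module Defs where

open import Data.Nat using (ℕ; zero; suc; _+_; _*_; _≤_; _<_)
open import Data.Fin using (Fin; toℕ)
open import Data.List using (List; []; _∷_; _++_; length)
open import Data.List.Relation.Unary.Unique.Propositional using (Unique)
open import Data.Product using (Σ; ∃; _×_; _,_)
open import Relation.Binary.PropositionalEquality using (_≡_)
open import Relation.Nullary using (¬_)

-- The sequence S = s₁, s₂, … is a function ℕ → C; s_i is S i for i ≥ 1
-- (the value S 0 is never used).

-- A vertex is the list of child choices on the path from it up to the
-- root (most recent choice first): [] is the root, c ∷ v is the c-th
-- child (0-based, left to right) of v.

Vertex : ℕ → Set
Vertex k = List (Fin k)

mutual
  edgeIndex : ∀ {k} → Fin k → Vertex k → ℕ
  edgeIndex c v = parentIndex v + suc (toℕ c)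

  -- index of the edge from v to its parent; 0 for the root, so that the
  -- root's children get indices 1..k and children of a vertex whose
  -- parent edge has index i get indices i+1..i+k.
  parentIndex : ∀ {k} → Vertex k → ℕ
  parentIndex [] = 0
  parentIndex (c ∷ v) = edgeIndex c v

data Adj {k : ℕ} : Vertex k → Vertex k → Set where
  down : ∀ (c : Fin k) (v : Vertex k) → Adj v (c ∷ v)
  up   : ∀ (c : Fin k) (v : Vertex k) → Adj (c ∷ v) v

adjIndex : ∀ {k} {u w : Vertex k} → Adj u w → ℕ
adjIndex (down c v) = edgeIndex c v
adjIndex (up c v) = edgeIndex c v

data Walk {k : ℕ} : Vertex k → Vertex k → Set where
  [] : ∀ {v} → Walk v v
  _∷_ : ∀ {u v w} → Adj u v → Walk v w → Walk u w

walkVertices : ∀ {k} {u w : Vertex k} → Walk u w → List (Vertex k)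
walkVertices {u = u} [] = u ∷ []
walkVertices {u = u} (e ∷ p) = u ∷ walkVertices p

walkColours : ∀ {k} {C : Set} (S : ℕ → C) {u w : Vertex k} → Walk u w → List C
walkColours S [] = []
walkColours S (e ∷ p) = S (adjIndex e) ∷ walkColours S p

IsPath : ∀ {k} {u w : Vertex k} → Walk u w → Set
IsPath p = Unique (walkVertices p)

IsRepetition : {C : Set} → List C → Set
IsRepetition {C} xs = Σ (List C) λ ys → (1 ≤ length ys) × (xs ≡ ys ++ ys)

Nonrepetitive : (k : ℕ) {C : Set} → (ℕ → C) → Set
Nonrepetitive k S = ∀ (u w : Vertex k) (p : Walk u w) → IsPath p →
  1 ≤ length (walkColours S p) → ¬ IsRepetition (walkColours S p)

-- k-bad sequences of indices i₁,…,i_{2r}, given as a function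
-- i : ℕ → ℕ of which only positions 1..2r matter.

record KBad (k : ℕ) {C : Set} (S : ℕ → C) (r : ℕ) (i : ℕ → ℕ) : Set where
  field
    r≥1     : 1 ≤ r
    indices : ∀ j → 1 ≤ j → j ≤ 2 * r → 1 ≤ i j
    m       : ℕ
    1<m     : 1 < m
    m≤2r    : m ≤ 2 * r
    cond-a  : ∀ j → 1 ≤ j → j ≤ r → S (i j) ≡ S (i (j + r))
    cond-b₁ : ∀ j → 1 ≤ j → j < m → i (suc j) < i j
    cond-b₂ : ∀ j → m ≤ j → j < 2 * r → i j < i (suc j)
    cond-c₁ : ∀ j → 1 ≤ j → j < 2 * r → i j ≤ i (suc j) + k
    cond-c₂ : ∀ j → 1 ≤ j → j < 2 * r → i (suc j) ≤ i j + k
    cond-d  : m < 2 * r → i (suc m) < i m + k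

Special : (k : ℕ) {C : Set} → (ℕ → C) → Set
Special k S = ∀ (r : ℕ) (i : ℕ → ℕ) → ¬ KBad k S r i

module Submission where

-- Along a path of T_k the edge index drops by 1..k at each upward step and grows by 1..k at
-- each downward step.  A path climbs and then descends, and where it turns it uses two distinct
-- edges below one vertex, whose indices differ by less than k.  Hence the index sequence of a
-- path, read forwards or backwards, has the shape of a k-bad sequence (a "valley"), so a
-- repetition along a path is a k-bad sequence.  Conversely, a valley of positive indices
-- i₁ > … > i_m < … < i_2r is the index sequence of a path: take the vertex y of the leftmost
-- branch whose parent edge has index i_m - 1, descend from y along i_{m+1}, …, i_2r, and climb
-- to the edge i_m from a descendant reached along i_{m-1}, …, i_1.  Both sides of the theorem
-- are thus equivalent to: no valley of positive indices carries a repetition of colours.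

open import Defs
open import Data.Nat using (ℕ; _≤_)
open import Function.Bundles using (_⇔_)

open import Data.Empty using (⊥-elim)
open import Data.Fin using (toℕ; fromℕ<)
open import Data.Fin.Properties using (toℕ-fromℕ<; toℕ-injective; toℕ<n)
open import Data.List
  using ( List; []; _∷_; _++_; _∷ʳ_; _ʳ++_; length; map; reverse; replicate; head; last; applyUpTo
        ; initLast; _∷ʳ′_ )
open import Data.List.Properties
  using ( ++-assoc; ++-identityʳ; length-++; length-++-sucʳ; length-++-≤ˡ; length-map; length-reverse
        ; reverse-++; reverse-involutive; reverse-map; unfold-reverse; ʳ++-defn
        ; length-applyUpTo; applyUpTo-∷ʳ; map-applyUpTo )
open import Data.List.Relation.Unary.All as All using (All; []; _∷_)
import Data.List.Relation.Unary.All.Properties as All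
import Data.List.Relation.Unary.Any.Properties as Any
open import Data.List.Relation.Unary.AllPairs using ([]; _∷_)
open import Data.List.Relation.Unary.Linked as Linked using (Linked; []; [-]; _∷_)
import Data.List.Relation.Unary.Linked.Properties as Linked
open import Data.Maybe using (just)
open import Data.Maybe.Relation.Binary.Connected using (Connected; just; just-nothing; nothing-just; nothing)
open import Data.Nat using (zero; suc; _+_; _*_; _<_; z≤n; s≤s)
open import Data.Nat.Properties
open import Data.Product using (_×_; _,_; proj₁; proj₂; ∃; ∃₂)
open import Data.Sum using (_⊎_; inj₁; inj₂)
open import Function using (_∘_; flip)
open import Function.Bundles using (mk⇔)
open import Relation.Binary.Definitions using (tri<; tri≈; tri>)
open import Relation.Binary.PropositionalEquality
open import Relation.Nullary using (¬_)

private
  variable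
    A : Set
    R : A → A → Set
    x : A
    xs ys : List A

nth : A → List A → ℕ → A
nth d []       _       = d
nth d (x ∷ xs) zero    = x
nth d (x ∷ xs) (suc j) = nth d xs j

nth-map : ∀ {B : Set} (f : A → B) d xs j → f (nth d xs j) ≡ nth (f d) (map f xs) j
nth-map f d []       j       = refl
nth-map f d (x ∷ xs) zero    = refl
nth-map f d (x ∷ xs) (suc j) = nth-map f d xs j

nth-++ˡ : ∀ (d : A) xs {ys j} → j < length xs → nth d (xs ++ ys) j ≡ nth d xs j
nth-++ˡ d (x ∷ xs) {j = zero}  _         = refl
nth-++ˡ d (x ∷ xs) {j = suc j} (s≤s j<n) = nth-++ˡ d xs j<n

nth-++ʳ : ∀ (d : A) xs {ys} j → nth d (xs ++ ys) (length xs + j) ≡ nth d ys j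
nth-++ʳ d []       j = refl
nth-++ʳ d (x ∷ xs) j = nth-++ʳ d xs j

nth-++-∷ : ∀ {d y : A} xs {ys} → nth d (xs ++ y ∷ ys) (length xs) ≡ y
nth-++-∷ []       = refl
nth-++-∷ (x ∷ xs) = nth-++-∷ xs

nth-++-∷-suc : ∀ {d y z : A} xs {ys} → nth d (xs ++ y ∷ z ∷ ys) (suc (length xs)) ≡ z
nth-++-∷-suc []       = refl
nth-++-∷-suc (x ∷ xs) = nth-++-∷-suc xs

All-nth : ∀ {P : A → Set} d → All P xs → ∀ {j} → j < length xs → P (nth d xs j)
All-nth d (p ∷ ps) {zero}  _         = p
All-nth d (p ∷ ps) {suc j} (s≤s j<n) = All-nth d ps j<n

All-reverse : ∀ {P : A → Set} → All P xs → All P (reverse xs)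
All-reverse ps = All.tabulate (All.lookup ps ∘ Any.reverse⁻)

Linked-nth : ∀ d → Linked R xs → ∀ {j} → suc j < length xs → R (nth d xs j) (nth d xs (suc j))
Linked-nth d [-]      {_}     (s≤s ())
Linked-nth d (r ∷ rs) {zero}  _         = r
Linked-nth d (r ∷ rs) {suc j} (s≤s j<n) = Linked-nth d rs j<n

Linked-nth-++ˡ : ∀ d xs {y ys} → Linked R (xs ∷ʳ y) → ∀ {j} → j < length xs →
                 R (nth d (xs ++ y ∷ ys) j) (nth d (xs ++ y ∷ ys) (suc j))
Linked-nth-++ˡ d (x ∷ [])      (r ∷ _)  {zero}  _         = r
Linked-nth-++ˡ d (x ∷ _ ∷ _)   (r ∷ _)  {zero}  _         = r
Linked-nth-++ˡ d (x ∷ [])      (_ ∷ _)  {suc j} (s≤s ())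
Linked-nth-++ˡ d (x ∷ x′ ∷ xs) (_ ∷ rs) {suc j} (s≤s j<n) = Linked-nth-++ˡ d (x′ ∷ xs) rs j<n

Linked-nth-++ʳ : ∀ d xs → Linked R ys → ∀ {t} → suc (length xs + t) < length (xs ++ ys) →
                 R (nth d (xs ++ ys) (length xs + t)) (nth d (xs ++ ys) (suc (length xs + t)))
Linked-nth-++ʳ d []       rs j<n       = Linked-nth d rs j<n
Linked-nth-++ʳ d (x ∷ xs) rs (s≤s j<n) = Linked-nth-++ʳ d xs rs j<n

Linked-join : ∀ xs → Linked R (xs ∷ʳ x) → Linked R (x ∷ ys) → Linked R (xs ++ x ∷ ys)
Linked-join []           _        rs = rs
Linked-join (y ∷ [])     (r ∷ _)  rs = r ∷ rs
Linked-join (y ∷ z ∷ xs) (r ∷ ls) rs = r ∷ Linked-join (z ∷ xs) ls rs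

Linked-ʳ++ : Linked R (x ∷ xs) → Linked (flip R) (x ∷ ys) → Linked (flip R) (xs ʳ++ x ∷ ys)
Linked-ʳ++ [-]     acc = acc
Linked-ʳ++ (r ∷ l) acc = Linked-ʳ++ l (r ∷ acc)

Linked-reverse : Linked R xs → Linked (flip R) (reverse xs)
Linked-reverse {xs = []}    [] = []
Linked-reverse {xs = _ ∷ _} l  = Linked-ʳ++ l [-]

last-∷ʳ : ∀ (xs : List A) x → last (xs ∷ʳ x) ≡ just x
last-∷ʳ []           x = refl
last-∷ʳ (y ∷ [])     x = refl
last-∷ʳ (y ∷ z ∷ xs) x = last-∷ʳ (z ∷ xs) x

applyUpTo-cong : ∀ {f g : ℕ → A} n → (∀ {t} → t < n → f t ≡ g t) → applyUpTo f n ≡ applyUpTo g n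
applyUpTo-cong zero    _  = refl
applyUpTo-cong (suc n) eq = cong₂ _∷_ (eq (s≤s z≤n)) (applyUpTo-cong n (eq ∘ s≤s))

applyUpTo-++ : ∀ (f : ℕ → A) a b → applyUpTo f (a + b) ≡ applyUpTo f a ++ applyUpTo (λ t → f (t + a)) b
applyUpTo-++ f zero    b = applyUpTo-cong b (λ {t} _ → cong f (sym (+-identityʳ t)))
applyUpTo-++ f (suc a) b = cong (f 0 ∷_) (begin
  applyUpTo (f ∘ suc) (a + b)                                  ≡⟨ applyUpTo-++ (f ∘ suc) a b ⟩
  applyUpTo (f ∘ suc) a ++ applyUpTo (λ t → f (suc (t + a))) b  ≡⟨ cong (applyUpTo (f ∘ suc) a ++_)
                                                                    (applyUpTo-cong b (λ {t} _ → cong f (sym (+-suc t a)))) ⟩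
  applyUpTo (f ∘ suc) a ++ applyUpTo (λ t → f (t + suc a)) b    ∎)
  where open ≡-Reasoning

repetition-period : ∀ (d : A) {xs ys} → xs ≡ ys ++ ys → ∀ {j} → j < length ys →
                    nth d xs j ≡ nth d xs (j + length ys)
repetition-period d {ys = ys} refl {j} j<n = begin
  nth d (ys ++ ys) j                ≡⟨ nth-++ˡ d ys j<n ⟩
  nth d ys j                        ≡⟨ nth-++ʳ d ys j ⟨
  nth d (ys ++ ys) (length ys + j)  ≡⟨ cong (nth d (ys ++ ys)) (+-comm (length ys) j) ⟩
  nth d (ys ++ ys) (j + length ys)  ∎
  where open ≡-Reasoning

repetition-length : IsRepetition xs → 2 ≤ length xs
repetition-length (ys , ys≢[] , refl) = subst (2 ≤_) (sym (length-++ ys)) (+-mono-≤ ys≢[] ys≢[])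

repetition-reverse : IsRepetition xs → IsRepetition (reverse xs)
repetition-reverse (ys , ys≢[] , refl) =
  reverse ys , subst (1 ≤_) (sym (length-reverse ys)) ys≢[] , reverse-++ ys ys

indexList : ℕ → (ℕ → ℕ) → List ℕ
indexList r i = applyUpTo (i ∘ suc) (2 * r)

module _ (k : ℕ) where

  -- Valleys

  Rises : ℕ → ℕ → Set
  Rises a b = a < b × b ≤ a + k

  Falls : ℕ → ℕ → Set
  Falls = flip Rises

  Close : ℕ → ℕ → Set
  Close a b = a ≤ b + k × b ≤ a + k

  Steep : ℕ → ℕ → Set
  Steep a b = b < a + k

  Siblings : ℕ → ℕ → Set
  Siblings a b = a ≢ b × Steep b a × Steep a b

  rises⇒close : ∀ {a b} → Rises a b → Close a b
  rises⇒close {a} {b} (a<b , b≤a+k) = ≤-trans (<⇒≤ a<b) (m≤m+n b k) , b≤a+k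

  falls⇒close : ∀ {a b} → Falls a b → Close a b
  falls⇒close {a} {b} (b<a , a≤b+k) = a≤b+k , ≤-trans (<⇒≤ b<a) (m≤m+n a k)

  -- The shape of a k-bad sequence with turning point m: descent = i₁ … i_{m-1},
  -- bottom = i_m, ascent = i_{m+1} … i_2r; falls, rises and steep are (b)–(d).
  record Valley (L : List ℕ) : Set where
    constructor valley
    field
      descent          : List ℕ
      bottom           : ℕ
      ascent           : List ℕ
      split            : L ≡ descent ++ bottom ∷ ascent
      descent-nonempty : 1 ≤ length descent
      falls            : Linked Falls (descent ∷ʳ bottom)
      rises            : Linked Rises (bottom ∷ ascent)
      steep            : Connected Steep (just bottom) (head ascent)

  valley-close : ∀ {L} → Valley L → Linked Close L
  valley-close (valley D x E refl _ fs rs _) = Linked-join D (Linked.map falls⇒close fs) (Linked.map rises⇒close rs)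

  falling-valley : ∀ {L} → Linked Falls L → 2 ≤ length L → Valley L
  falling-valley {L} fs len with initLast L
  falling-valley fs (s≤s ()) | [] ∷ʳ′ x
  falling-valley fs _        | (d ∷ D) ∷ʳ′ x = valley (d ∷ D) x [] refl (s≤s z≤n) fs [-] just-nothing

  rising-valley : ∀ {L} → Linked Rises L → 2 ≤ length L → Valley (reverse L)
  rising-valley {L} rs len = falling-valley (Linked-reverse rs) (subst (2 ≤_) (sym (length-reverse L)) len)

  turn-valley : ∀ U a b D → a < b → Steep a b → Linked Falls (U ∷ʳ a) → Linked Rises (b ∷ D) →
                Valley ((U ∷ʳ a) ++ b ∷ D) ⊎ Valley (reverse ((U ∷ʳ a) ++ b ∷ D))
  turn-valley []      a b D a<b b<a+k _  rs = inj₂ (rising-valley ((a<b , <⇒≤ b<a+k) ∷ rs) (s≤s (s≤s z≤n)))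
  turn-valley (u ∷ U) a b D a<b b<a+k fs rs = inj₁ (valley (u ∷ U) a (b ∷ D)
    (++-assoc (u ∷ U) (a ∷ []) (b ∷ D)) (s≤s z≤n) fs ((a<b , <⇒≤ b<a+k) ∷ rs) (just b<a+k))

  reverse-turn : ∀ (U : List ℕ) a b D → reverse ((U ∷ʳ a) ++ b ∷ D) ≡ (reverse D ∷ʳ b) ++ a ∷ reverse U
  reverse-turn U a b D = begin
    reverse ((U ∷ʳ a) ++ b ∷ D)         ≡⟨ reverse-++ (U ∷ʳ a) (b ∷ D) ⟩
    reverse (b ∷ D) ++ reverse (U ∷ʳ a) ≡⟨ cong₂ _++_ (unfold-reverse b D) (reverse-++ U (a ∷ [])) ⟩
    (reverse D ∷ʳ b) ++ a ∷ reverse U   ∎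
    where open ≡-Reasoning

  valley-mirror : ∀ {L L′} → reverse L ≡ L′ →
                  Valley L′ ⊎ Valley (reverse L′) → Valley L ⊎ Valley (reverse L)
  valley-mirror     refl (inj₁ v) = inj₂ v
  valley-mirror {L} refl (inj₂ v) = inj₁ (subst Valley (reverse-involutive L) v)

  -- us and ds are the indices of the upward and of the downward steps of a path.
  record UpDown (us ds : List ℕ) : Set where
    field
      falls : Linked Falls us
      rises : Linked Rises ds
      turn  : Connected Siblings (last us) (head ds)

  turn-siblings : ∀ U a b D → UpDown (U ∷ʳ a) (b ∷ D) → Siblings a b
  turn-siblings U a b D ud with last (U ∷ʳ a) | last-∷ʳ U a | UpDown.turn ud
  ... | .(just a) | refl | just s = s

  upDown-valley : ∀ {us ds} → UpDown us ds → 2 ≤ length (us ++ ds) →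
                  Valley (us ++ ds) ⊎ Valley (reverse (us ++ ds))
  upDown-valley {us} {[]} ud len rewrite ++-identityʳ us = inj₁ (falling-valley (UpDown.falls ud) len)
  upDown-valley {us} {b ∷ D} ud len with initLast us
  ... | [] = inj₂ (rising-valley (UpDown.rises ud) len)
  ... | U ∷ʳ′ a with turn-siblings U a b D ud | <-cmp a b
  ...   | _ , _ , b<a+k   | tri< a<b _ _ = turn-valley U a b D a<b b<a+k (UpDown.falls ud) (UpDown.rises ud)
  ...   | a≢b , _ , _     | tri≈ _ a≡b _ = ⊥-elim (a≢b a≡b)
  ...   | _ , a<b+k , _   | tri> _ _ b<a =
    valley-mirror (reverse-turn U a b D)
      (turn-valley (reverse D) b a (reverse U) b<a a<b+k
        (subst (Linked Falls) (unfold-reverse b D) (Linked-reverse (UpDown.rises ud)))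
        (subst (Linked Rises) (reverse-++ U (a ∷ [])) (Linked-reverse (UpDown.falls ud))))

  -- Index sequences of paths

  walkIndices : ∀ {u w : Vertex k} → Walk u w → List ℕ
  walkIndices []      = []
  walkIndices (e ∷ p) = adjIndex e ∷ walkIndices p

  edgeIndex-rises : ∀ c (v : Vertex k) → Rises (parentIndex v) (edgeIndex c v)
  edgeIndex-rises c v = m<m+n (parentIndex v) (s≤s z≤n) , +-monoʳ-≤ (parentIndex v) (toℕ<n c)

  walkIndices-positive : ∀ {u w} (p : Walk u w) → All (1 ≤_) (walkIndices p)
  walkIndices-positive []             = []
  walkIndices-positive (down c v ∷ p) = ≤-trans (s≤s z≤n) (proj₁ (edgeIndex-rises c v)) ∷ walkIndices-positive p
  walkIndices-positive (up c v ∷ p)   = ≤-trans (s≤s z≤n) (proj₁ (edgeIndex-rises c v)) ∷ walkIndices-positive p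

  child : ∀ (v : Vertex k) {h} → Rises (parentIndex v) h → ∃ λ c → edgeIndex c v ≡ h
  child v (P<h , h≤P+k) with m≤n⇒∃[o]m+o≡n P<h
  ... | o , refl = fromℕ< o<k , (begin
      P + suc (toℕ (fromℕ< o<k)) ≡⟨ cong (λ z → P + suc z) (toℕ-fromℕ< o<k) ⟩
      P + suc o                  ≡⟨ +-suc P o ⟩
      suc P + o                  ∎)
    where
    open ≡-Reasoning
    P = parentIndex v
    o<k : o < k
    o<k = +-cancelˡ-≤ P _ _ (subst (_≤ P + k) (sym (+-suc P o)) h≤P+k)

  siblings : ∀ c c′ (v : Vertex k) → c ≢ c′ → Siblings (edgeIndex c v) (edgeIndex c′ v)
  siblings c c′ v c≢c′ = distinct , steep c′ c , steep c c′
    where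
    P = parentIndex v
    distinct : edgeIndex c v ≢ edgeIndex c′ v
    distinct eq = c≢c′ (toℕ-injective (suc-injective (+-cancelˡ-≡ P _ _ eq)))
    steep : ∀ c c′ → Steep (edgeIndex c v) (edgeIndex c′ v)
    steep c c′ = ≤-<-trans (+-monoʳ-≤ P (toℕ<n c′)) (+-monoˡ-< k (m<m+n P (s≤s z≤n)))

  All-start : ∀ {P : Vertex k → Set} {u w} (p : Walk u w) → All P (walkVertices p) → P u
  All-start []      (q ∷ _) = q
  All-start (_ ∷ _) (q ∷ _) = q

  downward-rises : ∀ {c v w} (p : Walk (c ∷ v) w) → IsPath (down c v ∷ p) →
                   Linked Rises (edgeIndex c v ∷ walkIndices p)
  downward-rises []                _               = [-]
  downward-rises (down c′ cv ∷ p) (_ ∷ path)      = edgeIndex-rises c′ cv ∷ downward-rises p path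
  downward-rises (up _ v ∷ p)     ((_ ∷ v∉p) ∷ _) = ⊥-elim (All-start p v∉p refl)

  upward-upDown : ∀ {c v w} (p : Walk v w) → IsPath (up c v ∷ p) →
                  ∃₂ λ us ds → walkIndices p ≡ us ++ ds × UpDown (edgeIndex c v ∷ us) ds
  upward-upDown [] _ = [] , [] , refl , record { falls = [-] ; rises = [] ; turn = just-nothing }
  upward-upDown {c} (down c′ v ∷ p) ((_ ∷ cv∉p) ∷ path) =
    [] , _ , refl , record { falls = [-] ; rises = downward-rises p path ; turn = just (siblings c c′ v c≢c′) }
    where
    c≢c′ : c ≢ c′
    c≢c′ refl = All-start p cv∉p refl
  upward-upDown {c} (up c′ v′ ∷ p) (_ ∷ path) with upward-upDown p path
  ... | us , ds , eq , ud = _ ∷ us , ds , cong (_ ∷_) eq , record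
    { falls = edgeIndex-rises c (c′ ∷ v′) ∷ UpDown.falls ud
    ; rises = UpDown.rises ud
    ; turn  = UpDown.turn ud
    }

  path-upDown : ∀ {u w} (p : Walk u w) → IsPath p → ∃₂ λ us ds → walkIndices p ≡ us ++ ds × UpDown us ds
  path-upDown [] _ = [] , [] , refl , record { falls = [] ; rises = [] ; turn = nothing }
  path-upDown (down c v ∷ p) path =
    [] , _ , refl , record { falls = [] ; rises = downward-rises p path ; turn = nothing-just }
  path-upDown (up c v ∷ p) path with upward-upDown p path
  ... | us , ds , eq , ud = _ ∷ us , ds , cong (_ ∷_) eq , ud

  path-valley : ∀ {u w} (p : Walk u w) → IsPath p → 2 ≤ length (walkIndices p) →
                Valley (walkIndices p) ⊎ Valley (reverse (walkIndices p))
  path-valley p path len with path-upDown p path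
  ... | _ , _ , eq , ud = subst (λ L → Valley L ⊎ Valley (reverse L)) (sym eq)
                            (upDown-valley ud (subst (λ L → 2 ≤ length L) eq len))

  -- Paths with a prescribed index sequence

  infix 4 _≼_
  data _≼_ (s : Vertex k) : Vertex k → Set where
    ≼-refl : s ≼ s
    ≼-step : ∀ {c t} → s ≼ t → s ≼ c ∷ t

  ≼-length : ∀ {s t} → s ≼ t → length s ≤ length t
  ≼-length ≼-refl      = ≤-refl
  ≼-length (≼-step st) = m≤n⇒m≤1+n (≼-length st)

  child≼⇒≼ : ∀ {c s t} → c ∷ s ≼ t → s ≼ t
  child≼⇒≼ ≼-refl      = ≼-step ≼-refl
  child≼⇒≼ (≼-step st) = ≼-step (child≼⇒≼ st)

  child≼⇒≢ : ∀ {c s t} → c ∷ s ≼ t → s ≢ t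
  child≼⇒≢ st refl = 1+n≰n (≼-length st)

  ≼-children : ∀ {c c′ y t} → c ∷ y ≼ t → c′ ∷ y ≼ t → c ≡ c′
  ≼-children ≼-refl      ≼-refl       = refl
  ≼-children ≼-refl      (≼-step st′) = ⊥-elim (1+n≰n (≼-length st′))
  ≼-children (≼-step st) ≼-refl       = ⊥-elim (1+n≰n (≼-length st))
  ≼-children (≼-step st) (≼-step st′) = ≼-children st st′

  record IndexedPath (L : List ℕ) : Set where
    field
      {start end} : Vertex k
      walk        : Walk start end
      isPath      : IsPath walk
      indices     : walkIndices walk ≡ L

  record Descent (v : Vertex k) (L : List ℕ) : Set where
    field
      {end}     : Vertex k
      walk      : Walk v end
      isPath    : IsPath walk
      indices   : walkIndices walk ≡ L
      inSubtree : All (v ≼_) (walkVertices walk)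

  descent : ∀ v L → Linked Rises (parentIndex v ∷ L) → Descent v L
  descent v []      _        = record { walk = [] ; isPath = [] ∷ [] ; indices = refl ; inSubtree = ≼-refl ∷ [] }
  descent v (h ∷ L) (r ∷ rs) with child v r
  ... | c , refl = record
    { walk      = down c v ∷ walk
    ; isPath    = All.map child≼⇒≢ inSubtree ∷ isPath
    ; indices   = cong (edgeIndex c v ∷_) indices
    ; inSubtree = ≼-refl ∷ All.map child≼⇒≼ inSubtree
    }
    where open Descent (descent (c ∷ v) L rs)

  -- Every vertex of the subtree of top on such a path lies no deeper than s, so prepending
  -- an upward step from a child of s yields a path again.
  record ClimbablePath (top s : Vertex k) (L : List ℕ) : Set where
    field
      {end}   : Vertex k
      walk    : Walk s end
      isPath  : IsPath walk
      indices : walkIndices walk ≡ L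
      shallow : All (λ t → top ≼ t → length t ≤ length s) (walkVertices walk)

  climb : ∀ {top s L} → top ≼ s → ClimbablePath top s L → (R : List ℕ) → Linked Rises (parentIndex s ∷ R) →
          IndexedPath (R ʳ++ L)
  climb _ p [] _ = record { walk = walk ; isPath = isPath ; indices = indices }
    where open ClimbablePath p
  climb {top} {s} top≼s p (h ∷ R) (r ∷ rs) with child s r
  ... | c , refl = climb (≼-step top≼s) higher R rs
    where
    open ClimbablePath p
    fresh : ∀ {t} → (top ≼ t → length t ≤ length s) → c ∷ s ≢ t
    fresh shallow-t refl = 1+n≰n (shallow-t (≼-step top≼s))
    higher : ClimbablePath top (c ∷ s) _
    higher = record
      { walk    = up c s ∷ walk
      ; isPath  = All.map fresh shallow ∷ isPath
      ; indices = cong (edgeIndex c s ∷_) indices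
      ; shallow = (λ _ → ≤-refl) ∷ All.map (λ shallow-t → m≤n⇒m≤1+n ∘ shallow-t) shallow
      }

  turning-path : ∀ cu y E → Linked Rises (edgeIndex cu y ∷ E) → Linked Rises (parentIndex y ∷ E) →
                 ClimbablePath (cu ∷ y) (cu ∷ y) (edgeIndex cu y ∷ E)
  turning-path cu y [] _ _ = record
    { walk    = up cu y ∷ []
    ; isPath  = (≢-sym (child≼⇒≢ ≼-refl) ∷ []) ∷ [] ∷ []
    ; indices = refl
    ; shallow = (λ _ → ≤-refl) ∷ (λ _ → n≤1+n _) ∷ []
    }
  turning-path cu y (e ∷ E) ((cu<e , _) ∷ _) (r ∷ rs) with child y r
  ... | c , refl = record
    { walk    = up cu y ∷ down c y ∷ walk
    ; isPath  = (≢-sym (child≼⇒≢ ≼-refl) ∷ All.map (λ out eq → out (subst (cu ∷ y ≼_) eq ≼-refl)) outside)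
                ∷ All.map child≼⇒≢ inSubtree ∷ isPath
    ; indices = cong (λ L → edgeIndex cu y ∷ edgeIndex c y ∷ L) indices
    ; shallow = (λ _ → ≤-refl) ∷ (λ _ → n≤1+n _) ∷ All.map (λ out top≼t → ⊥-elim (out top≼t)) outside
    }
    where
    open Descent (descent (c ∷ y) E rs)
    outside : All (λ t → ¬ cu ∷ y ≼ t) (walkVertices walk)
    outside = All.map (λ cy≼t cuy≼t → <-irrefl (cong (λ c → edgeIndex c y) (≼-children cuy≼t cy≼t)) cu<e)
                      inSubtree

  spine : 0 < k → ℕ → Vertex k
  spine k>0 n = replicate n (fromℕ< k>0)

  parentIndex-spine : ∀ k>0 n → parentIndex (spine k>0 n) ≡ n
  parentIndex-spine k>0 zero    = refl
  parentIndex-spine k>0 (suc n) = begin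
    parentIndex (spine k>0 n) + suc (toℕ (fromℕ< k>0)) ≡⟨ cong₂ (λ a b → a + suc b) (parentIndex-spine k>0 n)
                                                                                  (toℕ-fromℕ< k>0) ⟩
    n + 1                                              ≡⟨ +-comm n 1 ⟩
    suc n                                              ∎
    where open ≡-Reasoning

  rises-suc : 0 < k → ∀ n → Rises n (suc n)
  rises-suc k>0 n = n<1+n n , subst (_≤ n + k) (+-comm n 1) (+-monoʳ-≤ n k>0)

  steep-rises-from-pred : ∀ {n E} → Linked Rises (suc n ∷ E) → Connected Steep (just (suc n)) (head E) →
                          Linked Rises (n ∷ E)
  steep-rises-from-pred [-]              _              = [-]
  steep-rises-from-pred ((n<e , _) ∷ rs) (just e<1+n+k) = (<-trans (n<1+n _) n<e , ≤-pred e<1+n+k) ∷ rs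

  -- y lies on the leftmost branch and its parent edge has index x, so the bottom suc x is the
  -- index of an edge cu below y, and steep rises from suc x are again indices of edges below y.
  valley-path : ∀ {L} → 0 < k → Valley L → All (1 ≤_) L → IndexedPath L
  valley-path k>0 (valley D zero E refl _ _ _ _) pos with All.++⁻ʳ D pos
  ... | () ∷ _
  valley-path k>0 (valley D (suc x) E refl _ fs rs steep) pos
    with child (spine k>0 x) (subst (λ z → Rises z (suc x)) (sym (parentIndex-spine k>0 x)) (rises-suc k>0 x))
  ... | cu , cu-index = subst IndexedPath indices
    (climb ≼-refl
      (turning-path cu y E (from cu-index rs) (from (parentIndex-spine k>0 x) (steep-rises-from-pred rs steep)))
      (reverse D) (from cu-index (subst (Linked Rises) (reverse-++ D (suc x ∷ [])) (Linked-reverse fs))))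
    where
    y = spine k>0 x
    from : ∀ {n m E} → n ≡ m → Linked Rises (m ∷ E) → Linked Rises (n ∷ E)
    from refl rs = rs
    indices : reverse D ʳ++ edgeIndex cu y ∷ E ≡ D ++ suc x ∷ E
    indices = begin
      reverse D ʳ++ edgeIndex cu y ∷ E ≡⟨ cong (λ z → reverse D ʳ++ z ∷ E) cu-index ⟩
      reverse D ʳ++ suc x ∷ E          ≡⟨ ʳ++-defn (reverse D) ⟩
      reverse (reverse D) ++ suc x ∷ E ≡⟨ cong (_++ suc x ∷ E) (reverse-involutive D) ⟩
      D ++ suc x ∷ E                   ∎
      where open ≡-Reasoning

  -- Valleys and k-bad sequences

  module _ {C : Set} (S : ℕ → C) where

    -- i j is the j-th entry of L, counting from 1
    valley⇒kBad : ∀ {L ys} → Valley L → All (1 ≤_) L → map S L ≡ ys ++ ys → 1 ≤ length ys →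
                  KBad k S (length ys) (nth 0 (0 ∷ L))
    valley⇒kBad {ys = ys} V@(valley D x E refl D≢[] fs rs steep) pos rep ys≢[] = record
      { r≥1     = ys≢[]
      ; indices = λ { (suc j) _ j<2r → All-nth 0 pos (in-range j<2r) }
      ; m       = suc (length D)
      ; 1<m     = s≤s D≢[]
      ; m≤2r    = subst (suc (length D) ≤_) (trans (sym (length-++-sucʳ D x E)) (sym length-L))
                    (s≤s (length-++-≤ˡ D))
      ; cond-a  = λ { (suc j) _ j<r → period j<r }
      ; cond-b₁ = λ { (suc j) _ (s≤s j<D) → proj₁ (Linked-nth-++ˡ 0 D fs j<D) }
      ; cond-b₂ = λ { (suc j) (s≤s D≤j) j<2r → proj₁ (rises-at D≤j (in-range j<2r)) }
      ; cond-c₁ = λ { (suc j) _ j<2r → proj₁ (Linked-nth 0 (valley-close V) (in-range j<2r)) }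
      ; cond-c₂ = λ { (suc j) _ j<2r → proj₂ (Linked-nth 0 (valley-close V) (in-range j<2r)) }
      ; cond-d  = λ m<2r → turn-steep E steep (in-range m<2r)
      }
      where
      open ≡-Reasoning
      L = D ++ x ∷ E
      r = length ys
      length-L : 2 * r ≡ length L
      length-L = begin
        2 * r             ≡⟨ cong (r +_) (+-identityʳ r) ⟩
        r + r             ≡⟨ length-++ ys ⟨
        length (ys ++ ys) ≡⟨ cong length rep ⟨
        length (map S L)  ≡⟨ length-map S L ⟩
        length L          ∎
      in-range : ∀ {j} → j < 2 * r → j < length L
      in-range = subst (_ <_) length-L
      period : ∀ {j} → j < r → S (nth 0 L j) ≡ S (nth 0 L (j + r))
      period {j} j<r = begin
        S (nth 0 L j)                 ≡⟨ nth-map S 0 L j ⟩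
        nth (S 0) (map S L) j         ≡⟨ repetition-period (S 0) {ys = ys} rep j<r ⟩
        nth (S 0) (map S L) (j + r)   ≡⟨ nth-map S 0 L (j + r) ⟨
        S (nth 0 L (j + r))           ∎
      rises-at : ∀ {j} → length D ≤ j → suc j < length L → Rises (nth 0 L j) (nth 0 L (suc j))
      rises-at D≤j with m≤n⇒∃[o]m+o≡n D≤j
      ... | t , refl = Linked-nth-++ʳ 0 D rs
      turn-steep : ∀ E → Connected Steep (just x) (head E) → suc (length D) < length (D ++ x ∷ E) →
                   Steep (nth 0 (D ++ x ∷ E) (length D)) (nth 0 (D ++ x ∷ E) (suc (length D)))
      turn-steep [] _ m<2r =
        ⊥-elim (<-irrefl (sym (trans (length-++-sucʳ D x []) (cong (suc ∘ length) (++-identityʳ D)))) m<2r)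
      turn-steep (e ∷ E) (just e<x+k) _ = subst₂ Steep (sym (nth-++-∷ D)) (sym (nth-++-∷-suc D)) e<x+k

    kBad-valley : ∀ {r i} → KBad k S r i → Valley (indexList r i)
    kBad-valley {r} {i} record { m = suc m′ ; 1<m = s≤s m′≥1 ; m≤2r = m≤2r
                               ; cond-b₁ = b₁ ; cond-b₂ = b₂ ; cond-c₁ = c₁ ; cond-c₂ = c₂ ; cond-d = d }
      with m≤n⇒∃[o]m+o≡n m≤2r
    ... | q , m+q≡2r = valley
      (applyUpTo f m′) (f m′) (applyUpTo (λ t → f (suc t + m′)) q)
      (begin
        applyUpTo f (2 * r)        ≡⟨ cong (applyUpTo f) (trans (sym m+q≡2r) (sym (+-suc m′ q))) ⟩
        applyUpTo f (m′ + suc q)   ≡⟨ applyUpTo-++ f m′ (suc q) ⟩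
        applyUpTo f m′ ++ applyUpTo (λ t → f (t + m′)) (suc q) ∎)
      (subst (1 ≤_) (sym (length-applyUpTo f m′)) m′≥1)
      (subst (Linked Falls) (sym (applyUpTo-∷ʳ f m′)) (Linked.applyUpTo⁺₁ f (suc m′) λ {t} t<m →
        b₁ (suc t) (s≤s z≤n) t<m , c₁ (suc t) (s≤s z≤n) (<-≤-trans t<m m≤2r)))
      (Linked.applyUpTo⁺₁ (λ t → f (t + m′)) (suc q) λ {t} t<q →
        b₂ (suc (t + m′)) (s≤s (m≤n+m m′ t)) (after-m t<q) , c₂ (suc (t + m′)) (s≤s z≤n) (after-m t<q))
      (steep q m+q≡2r)
      where
      open ≡-Reasoning
      f = i ∘ suc
      after-m : ∀ {t} → suc t < suc q → suc (t + m′) < 2 * r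
      after-m {t} t<q = subst (suc (suc t) + m′ ≤_) (trans (+-comm (suc q) m′) (trans (+-suc m′ q) m+q≡2r))
                          (+-monoˡ-≤ m′ t<q)
      steep : ∀ q → suc m′ + q ≡ 2 * r →
              Connected Steep (just (f m′)) (head (applyUpTo (λ t → f (suc t + m′)) q))
      steep zero    _      = just-nothing
      steep (suc q) m+q≡2r = just (d (subst (suc m′ <_) m+q≡2r (m<m+n (suc m′) (s≤s z≤n))))

    kBad-positive : ∀ {r i} → KBad k S r i → All (1 ≤_) (indexList r i)
    kBad-positive {r} {i} bad =
      All.applyUpTo⁺₁ (i ∘ suc) (2 * r) λ t<2r → KBad.indices bad (suc _) (s≤s z≤n) t<2r

    kBad-repetition : ∀ {r i} → KBad k S r i → IsRepetition (map S (indexList r i))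
    kBad-repetition {r} {i} bad = half , subst (1 ≤_) (sym (length-applyUpTo (S ∘ f) r)) (KBad.r≥1 bad) , (begin
      map S (applyUpTo f (r + (r + 0)))               ≡⟨ map-applyUpTo f S (r + (r + 0)) ⟩
      applyUpTo (S ∘ f) (r + (r + 0))                  ≡⟨ applyUpTo-++ (S ∘ f) r (r + 0) ⟩
      half ++ applyUpTo (λ t → S (f (t + r))) (r + 0)  ≡⟨ cong (λ n → half ++ applyUpTo (λ t → S (f (t + r))) n)
                                                             (+-identityʳ r) ⟩
      half ++ applyUpTo (λ t → S (f (t + r))) r        ≡⟨ cong (half ++_) (applyUpTo-cong r λ t<r →
                                                             KBad.cond-a bad (suc _) (s≤s z≤n) t<r) ⟨
      half ++ half                                     ∎)
      where
      open ≡-Reasoning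
      f = i ∘ suc
      half = applyUpTo (S ∘ f) r

    walkColours-indices : ∀ {u w} (p : Walk u w) → walkColours S p ≡ map S (walkIndices p)
    walkColours-indices []      = refl
    walkColours-indices (e ∷ p) = cong (S (adjIndex e) ∷_) (walkColours-indices p)

    NonrepetitiveValleys : Set
    NonrepetitiveValleys = ∀ L → Valley L → All (1 ≤_) L → ¬ IsRepetition (map S L)

    special⇒nonrepetitiveValleys : Special k S → NonrepetitiveValleys
    special⇒nonrepetitiveValleys special L V pos (ys , ys≢[] , rep) =
      special (length ys) _ (valley⇒kBad {ys = ys} V pos rep ys≢[])

    nonrepetitiveValleys⇒special : NonrepetitiveValleys → Special k S
    nonrepetitiveValleys⇒special nrv r i bad = nrv _ (kBad-valley bad) (kBad-positive bad) (kBad-repetition bad)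

    nonrepetitiveValleys⇒nonrepetitive : NonrepetitiveValleys → Nonrepetitive k S
    nonrepetitiveValleys⇒nonrepetitive nrv u w p path _ rep =
      indices-nonrepetitive (subst IsRepetition (walkColours-indices p) rep)
      where
      indices-nonrepetitive : ¬ IsRepetition (map S (walkIndices p))
      indices-nonrepetitive rep
        with path-valley p path (subst (2 ≤_) (length-map S (walkIndices p)) (repetition-length rep))
      ... | inj₁ V = nrv _ V (walkIndices-positive p) rep
      ... | inj₂ V = nrv _ V (All-reverse (walkIndices-positive p))
                       (subst IsRepetition (sym (reverse-map S (walkIndices p))) (repetition-reverse rep))

    nonrepetitive⇒nonrepetitiveValleys : 0 < k → Nonrepetitive k S → NonrepetitiveValleys
    nonrepetitive⇒nonrepetitiveValleys k>0 nr L V pos rep =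
      nr _ _ walk isPath (≤-trans (s≤s z≤n) (repetition-length rep′)) rep′
      where
      open IndexedPath (valley-path k>0 V pos)
      rep′ = subst IsRepetition (sym (trans (walkColours-indices walk) (cong (map S) indices))) rep

theorem5 : (k : ℕ) → 1 ≤ k → {C : Set} → (S : ℕ → C) →
    Special k S ⇔ Nonrepetitive k S
theorem5 k k≥1 S = mk⇔
  (nonrepetitiveValleys⇒nonrepetitive k S ∘ special⇒nonrepetitiveValleys k S)
  (nonrepetitiveValleys⇒special k S ∘ nonrepetitive⇒nonrepetitiveValleys k S k≥1)
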